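{- Let $G$ be a block graph with $n$ vertices and $k$ cut-vertices. Then $meg(G)=n-k$.
   Context: All graphs are finite and simple. A block graph is a graph whose $2$-connected components (blocks) are cliques. A pair of vertices $u,v$ (or any vertex set containing them) monitors an edge $e$ if $e$ lies on every shortest $u$–$v$ path. A monitoring edge-geodetic set (MEG-set) of $G$ is a set $M\subseteq V(G)$ such that every edge of $G$ is monitored by some pair of vertices of $M$; $meg(G)$ is the minimum size of an MEG-set. -}

module Defs where

open import Data.Nat using (ℕ; zero; suc; _≤_)
open import Data.Bool using (Bool; true; false)
open import Data.Fin using (Fin)
open import Data.Fin.Subset using (Subset; _∈_; _⊆_; ∣_∣; ⊤)
open import Data.List using (List; []; _∷_)
open import Data.List.Relation.Unary.All using (All)
import Data.List.Membership.Propositional as LM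
open import Data.Product using (Σ; _×_; ∃; ∃-syntax; _,_)
open import Data.Sum using (_⊎_)
open import Data.Empty using (⊥)
open import Relation.Binary.PropositionalEquality using (_≡_; _≢_)

record Graph (n : ℕ) : Set where
  field
    adj    : Fin n → Fin n → Bool
    adj-sym    : ∀ u v → adj u v ≡ adj v u
    adj-irrefl : ∀ v → adj v v ≡ false

module _ {n : ℕ} (G : Graph n) where
  open Graph G

  Edge : Fin n → Fin n → Set
  Edge u v = adj u v ≡ true

  data Walk : Fin n → Fin n → Set where
    []  : ∀ {u} → Walk u u
    _∷_ : ∀ {u w v} → Edge u w → Walk w v → Walk u v

  len : ∀ {u v} → Walk u v → ℕ
  len []      = zero
  len (_ ∷ p) = suc (len p)

  verts : ∀ {u v} → Walk u v → List (Fin n)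
  verts {u} []      = u ∷ []
  verts {u} (_ ∷ p) = u ∷ verts p

  UsesEdge : ∀ {u v} → Fin n → Fin n → Walk u v → Set
  UsesEdge a b []            = ⊥
  UsesEdge a b (_∷_ {u} {w} _ p) = ((u ≡ a × w ≡ b) ⊎ (u ≡ b × w ≡ a)) ⊎ UsesEdge a b p

  Shortest : ∀ {u v} → Walk u v → Set
  Shortest {u} {v} p = ∀ (q : Walk u v) → len p ≤ len q

  Connected : Set
  Connected = ∀ u v → Walk u v

  Monitors : Fin n → Fin n → Fin n → Fin n → Set
  Monitors u v a b = ∀ (p : Walk u v) → Shortest p → UsesEdge a b p

  IsMEGSet : Subset n → Set
  IsMEGSet M = ∀ a b → Edge a b →
    ∃[ u ] ∃[ v ] (u ∈ M × v ∈ M × Monitors u v a b)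

  MegIs : ℕ → Set
  MegIs m = (∃[ M ] (IsMEGSet M × ∣ M ∣ ≡ m))
          × (∀ M → IsMEGSet M → m ≤ ∣ M ∣)

  -- walks staying inside the vertex set B (i.e. walks in the induced subgraph G[B])
  WalkIn : Subset n → ∀ {u v} → Walk u v → Set
  WalkIn B p = All (_∈ B) (verts p)

  CutVertexIn : Subset n → Fin n → Set
  CutVertexIn B v = v ∈ B × ∃[ x ] ∃[ y ]
    (x ∈ B × y ∈ B × x ≢ v × y ≢ v ×
     ∀ (p : Walk x y) → WalkIn B p → v LM.∈ verts p)

  CutVertex : Fin n → Set
  CutVertex = CutVertexIn ⊤

  Nonseparable : Subset n → Set
  Nonseparable B =
    (∀ x y → x ∈ B → y ∈ B → Σ (Walk x y) (WalkIn B))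
    × (∀ v → CutVertexIn B v → ⊥)

  IsBlock : Subset n → Set
  IsBlock B = Nonseparable B × (∀ B′ → B ⊆ B′ → Nonseparable B′ → B′ ⊆ B)

  IsClique : Subset n → Set
  IsClique B = ∀ x y → x ∈ B → y ∈ B → x ≢ y → Edge x y

  BlockGraph : Set
  BlockGraph = ∀ B → IsBlock B → IsClique B

{-# OPTIONS --safe #-}
-- The key fact is that in a block graph two neighbours of a vertex w that are joined by a walk
-- avoiding w are adjacent: with w they lie on a cycle, whose vertex set is nonseparable, hence
-- inside a block, hence a clique. So non-cut vertices are simplicial; a simplicial vertex is never
-- an inner vertex of a shortest path, so every MEG-set contains all n - k non-cut vertices.
-- Conversely the same fact makes induced paths unique between their ends, so an induced path is
-- the only shortest path between its ends and monitors all its edges. An induced path starting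
-- at a cut vertex can be prolonged by a neighbour not adjacent to its second vertex, so every
-- edge lies on an induced path between two non-cut vertices.
module Submission where

open import Defs
open import Data.Nat using (ℕ; _≤_; _∸_)
open import Data.Fin.Subset using (Subset; _∈_; ∣_∣)
open import Function.Bundles using (_⇔_)

open import Data.Bool using (true)
import Data.Bool.Properties as Bool
open import Data.Empty using (⊥; ⊥-elim)
open import Data.Fin as Fin using (Fin; zero; suc; punchIn)
open import Data.Fin.Properties using (_≟_; any?; pigeonhole; punchInᵢ≢i)
open import Data.Fin.Subset using (_⊆_; ⁅_⁆; _∪_; ∁) renaming (⊥ to ∅)
open import Data.Fin.Subset.Properties
  using (_∈?_; ∉⊥; ∈⊤; x∈⁅x⁆; x∈⁅y⁆⇒x≡y; x∈p∪q⁺; x∈p∪q⁻; ∣p∣≤n; p⊂q⇒∣p∣<∣q∣;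
         p⊆q⇒∣p∣≤∣q∣; ∣∁p∣≡n∸∣p∣; x∉p⇒x∈∁p; x∈∁p⇒x∉p)
open import Data.List as List using (List; []; _∷_; length)
open import Data.List.Membership.Propositional using () renaming (_∈_ to _∈ₗ_; _∉_ to _∉ₗ_)
open import Data.List.Membership.Propositional.Properties using (∈-lookup)
open import Data.List.Relation.Binary.Subset.Propositional using () renaming (_⊆_ to _⊆ₗ_)
open import Data.List.Relation.Unary.All as All using ([]; _∷_)
open import Data.List.Relation.Unary.All.Properties using (¬Any⇒All¬)
open import Data.List.Relation.Unary.Any using (here; there)
open import Data.List.Relation.Unary.Unique.Propositional using (Unique; []; _∷_)
open import Data.List.Relation.Unary.Unique.Propositional.Properties using (Unique[x∷xs]⇒x∉xs)
open import Data.Nat using (zero; suc; _+_; _<_; s≤s; z≤n)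
import Data.Nat.Properties as ℕ
open import Data.Product using (Σ; ∃-syntax; _×_; _,_; proj₁; proj₂)
open import Data.Sum as Sum using (_⊎_; inj₁; inj₂; [_,_])
open import Function using (_∘_; id)
open import Function.Bundles using (Equivalence)
open import Relation.Nullary using (¬_; Dec; yes; no; ¬?)
open import Relation.Nullary.Decidable using (decidable-stable; _×-dec_)
import Relation.Nullary.Decidable as Dec
open import Relation.Unary using (Decidable)
open import Relation.Binary.PropositionalEquality using (_≡_; _≢_; refl; sym; trans; subst; cong)
open import Induction.WellFounded using (Acc; acc)
open import Data.Nat.Induction using (<-wellFounded)

private variable
  n : ℕ

vertexSet : List (Fin n) → Subset n
vertexSet = List.foldr (λ x S → ⁅ x ⁆ ∪ S) ∅

module _ {x : Fin n} where

  ∈-vertexSet⁺ : ∀ {xs} → x ∈ₗ xs → x ∈ vertexSet xs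
  ∈-vertexSet⁺ (here refl) = x∈p∪q⁺ (inj₁ (x∈⁅x⁆ x))
  ∈-vertexSet⁺ (there x∈xs) = x∈p∪q⁺ (inj₂ (∈-vertexSet⁺ x∈xs))

  ∈-vertexSet⁻ : ∀ xs → x ∈ vertexSet xs → x ∈ₗ xs
  ∈-vertexSet⁻ [] x∈⊥ = ⊥-elim (∉⊥ x∈⊥)
  ∈-vertexSet⁻ (y ∷ ys) x∈S with x∈p∪q⁻ ⁅ y ⁆ (vertexSet ys) x∈S
  ... | inj₁ x∈⁅y⁆ = here (x∈⁅y⁆⇒x≡y y x∈⁅y⁆)
  ... | inj₂ x∈ys = there (∈-vertexSet⁻ ys x∈ys)

unique⇒lookup≢ : {A : Set} {xs : List A} → Unique xs →
  ∀ {i j} → i Fin.< j → List.lookup xs i ≢ List.lookup xs j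
unique⇒lookup≢ (x≢xs ∷ _) {zero} {suc j} _ = All.lookup x≢xs (∈-lookup j)
unique⇒lookup≢ (_ ∷ xs!) {suc i} {suc j} (s≤s i<j) = unique⇒lookup≢ xs! i<j

unique⇒length≤ : {xs : List (Fin n)} → Unique xs → length xs ≤ n
unique⇒length≤ {n} {xs} xs! = decidable-stable (length xs ℕ.≤? n) λ ≰n →
  let i , j , i<j , lookup-i≡lookup-j = pigeonhole (ℕ.≰⇒> ≰n) (List.lookup xs)
  in unique⇒lookup≢ xs! i<j lookup-i≡lookup-j

¬¬maximal-superset : (P : Subset n → Set) {S : Subset n} → P S →
  ¬ ¬ (∃[ B ] S ⊆ B × P B × (∀ B′ → B ⊆ B′ → P B′ → B′ ⊆ B))
¬¬maximal-superset {n} P {S} PS no-maximal = grow n S id PS (ℕ.m≤n+m n ∣ S ∣)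
  where
  grow : ∀ k T → S ⊆ T → P T → n ≤ ∣ T ∣ + k → ⊥
  grow k T S⊆T PT n≤∣T∣+k = no-maximal (T , S⊆T , PT , maximal)
    where
    maximal : ∀ B′ → T ⊆ B′ → P B′ → B′ ⊆ T
    maximal B′ T⊆B′ PB′ {x} x∈B′ = decidable-stable (x ∈? T) λ x∉T →
      larger k (p⊂q⇒∣p∣<∣q∣ (T⊆B′ , x , x∈B′ , x∉T)) n≤∣T∣+k
      where
      larger : ∀ k → ∣ T ∣ < ∣ B′ ∣ → n ≤ ∣ T ∣ + k → ⊥
      larger zero ∣T∣<∣B′∣ n≤∣T∣+0 =
        ℕ.<⇒≱ ∣T∣<∣B′∣ (ℕ.≤-trans (∣p∣≤n B′) (subst (n ≤_) (ℕ.+-identityʳ _) n≤∣T∣+0))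
      larger (suc k) ∣T∣<∣B′∣ n≤∣T∣+1+k = grow k B′ (T⊆B′ ∘ S⊆T) PB′
        (ℕ.≤-trans n≤∣T∣+1+k (subst (_≤ ∣ B′ ∣ + k) (sym (ℕ.+-suc ∣ T ∣ k)) (ℕ.+-monoˡ-≤ k ∣T∣<∣B′∣)))

another-vertex : 2 ≤ n → (v : Fin n) → ∃[ w ] w ≢ v
another-vertex (s≤s (s≤s _)) v = punchIn v zero , punchInᵢ≢i v zero

module _ {n : ℕ} (G : Graph n) where
  open Graph G
  open import Data.List.Membership.DecPropositional (_≟_ {n}) using () renaming (_∈?_ to _∈ₗ?_)

  private variable
    a b r u v w x y y₁ y₂ z : Fin n

  edge? : ∀ u v → Dec (Edge G u v)
  edge? u v = adj u v Bool.≟ true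

  edge-sym : Edge G u v → Edge G v u
  edge-sym {u} {v} uv = trans (adj-sym v u) uv

  edge⇒≢ : Edge G u v → u ≢ v
  edge⇒≢ {u} uu refl with trans (sym (adj-irrefl u)) uu
  ... | ()

  source∈verts : (p : Walk G u v) → u ∈ₗ verts G p
  source∈verts [] = here refl
  source∈verts (_ ∷ _) = here refl

  target∈verts : (p : Walk G u v) → v ∈ₗ verts G p
  target∈verts [] = here refl
  target∈verts (_ ∷ p) = there (target∈verts p)

  uses⇒∈verts : (p : Walk G u v) → UsesEdge G a b p → a ∈ₗ verts G p
  uses⇒∈verts (_ ∷ p) (inj₁ (inj₁ (refl , _))) = here refl
  uses⇒∈verts (_ ∷ p) (inj₁ (inj₂ (_ , refl))) = there (source∈verts p)
  uses⇒∈verts (_ ∷ p) (inj₂ uses) = there (uses⇒∈verts p uses)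

  infixr 5 _++_
  _++_ : Walk G u v → Walk G v w → Walk G u w
  [] ++ q = q
  (e ∷ p) ++ q = e ∷ (p ++ q)

  reverse : Walk G u v → Walk G v u
  reverse [] = []
  reverse (e ∷ p) = reverse p ++ (edge-sym e ∷ [])

  ∈-++⁻ : (p : Walk G u v) {q : Walk G v w} →
          x ∈ₗ verts G (p ++ q) → x ∈ₗ verts G p ⊎ x ∈ₗ verts G q
  ∈-++⁻ [] x∈q = inj₂ x∈q
  ∈-++⁻ (_ ∷ p) (here refl) = inj₁ (here refl)
  ∈-++⁻ (_ ∷ p) (there x∈) = Sum.map there id (∈-++⁻ p x∈)

  ∈-reverse⁻ : (p : Walk G u v) → x ∈ₗ verts G (reverse p) → x ∈ₗ verts G p
  ∈-reverse⁻ [] x∈ = x∈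
  ∈-reverse⁻ (e ∷ p) x∈ with ∈-++⁻ (reverse p) x∈
  ... | inj₁ x∈p = there (∈-reverse⁻ p x∈p)
  ... | inj₂ (here refl) = there (source∈verts p)
  ... | inj₂ (there (here refl)) = here refl

  uses-++ˡ : (p : Walk G u v) {q : Walk G v w} → UsesEdge G a b p → UsesEdge G a b (p ++ q)
  uses-++ˡ (_ ∷ p) (inj₁ head) = inj₁ head
  uses-++ˡ (_ ∷ p) (inj₂ uses) = inj₂ (uses-++ˡ p uses)

  uses-++ʳ : (p : Walk G u v) {q : Walk G v w} → UsesEdge G a b q → UsesEdge G a b (p ++ q)
  uses-++ʳ [] uses = uses
  uses-++ʳ (_ ∷ p) uses = inj₂ (uses-++ʳ p uses)

  uses-reverse : (p : Walk G u v) → UsesEdge G a b p → UsesEdge G a b (reverse p)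
  uses-reverse (_ ∷ p) (inj₁ (inj₁ (u≡a , w≡b))) = uses-++ʳ (reverse p) (inj₁ (inj₂ (w≡b , u≡a)))
  uses-reverse (_ ∷ p) (inj₁ (inj₂ (u≡b , w≡a))) = uses-++ʳ (reverse p) (inj₁ (inj₁ (w≡a , u≡b)))
  uses-reverse (_ ∷ p) (inj₂ uses) = uses-++ˡ (reverse p) (uses-reverse p uses)

  prefixTo : (p : Walk G u v) → x ∈ₗ verts G p → Walk G u x
  prefixTo [] (here refl) = []
  prefixTo (_ ∷ _) (here refl) = []
  prefixTo (e ∷ p) (there x∈p) = e ∷ prefixTo p x∈p

  suffixFrom : (p : Walk G u v) → x ∈ₗ verts G p → Walk G x v
  suffixFrom [] (here refl) = []
  suffixFrom (e ∷ p) (here refl) = e ∷ p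
  suffixFrom (_ ∷ p) (there x∈p) = suffixFrom p x∈p

  prefixTo-⊆ : (p : Walk G u v) (x∈p : x ∈ₗ verts G p) → verts G (prefixTo p x∈p) ⊆ₗ verts G p
  prefixTo-⊆ [] (here refl) = id
  prefixTo-⊆ (_ ∷ _) (here refl) (here refl) = here refl
  prefixTo-⊆ (_ ∷ p) (there x∈p) (here refl) = here refl
  prefixTo-⊆ (_ ∷ p) (there x∈p) (there y∈) = there (prefixTo-⊆ p x∈p y∈)

  suffixFrom-⊆ : (p : Walk G u v) (x∈p : x ∈ₗ verts G p) → verts G (suffixFrom p x∈p) ⊆ₗ verts G p
  suffixFrom-⊆ [] (here refl) = id
  suffixFrom-⊆ (_ ∷ _) (here refl) = id
  suffixFrom-⊆ (_ ∷ p) (there x∈p) = there ∘ suffixFrom-⊆ p x∈p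

  len-suffixFrom : (p : Walk G u v) (x∈p : x ∈ₗ verts G p) → len G (suffixFrom p x∈p) ≤ len G p
  len-suffixFrom [] (here refl) = z≤n
  len-suffixFrom (_ ∷ _) (here refl) = ℕ.≤-refl
  len-suffixFrom (_ ∷ p) (there x∈p) = ℕ.m≤n⇒m≤1+n (len-suffixFrom p x∈p)

  len-suffixFrom< : (p : Walk G u v) (x∈p : x ∈ₗ verts G p) → x ≢ u →
                    len G (suffixFrom p x∈p) < len G p
  len-suffixFrom< [] (here refl) x≢u = ⊥-elim (x≢u refl)
  len-suffixFrom< (_ ∷ _) (here refl) x≢u = ⊥-elim (x≢u refl)
  len-suffixFrom< (_ ∷ p) (there x∈p) _ = s≤s (len-suffixFrom p x∈p)

  connect-within : (p : Walk G u v) → x ∈ₗ verts G p → y ∈ₗ verts G p →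
                   Σ (Walk G x y) λ s → verts G s ⊆ₗ verts G p
  connect-within p x∈p y∈p =
    reverse (prefixTo p x∈p) ++ prefixTo p y∈p ,
    [ prefixTo-⊆ p x∈p ∘ ∈-reverse⁻ (prefixTo p x∈p) , prefixTo-⊆ p y∈p ] ∘ ∈-++⁻ (reverse (prefixTo p x∈p))

  -- Paths and induced paths

  IsPath : Walk G u v → Set
  IsPath p = Unique (verts G p)

  path-∷ : (e : Edge G u w) (p : Walk G w v) → u ∉ₗ verts G p → IsPath p → IsPath (e ∷ p)
  path-∷ e p u∉p p! = ¬Any⇒All¬ (verts G p) u∉p ∷ p!

  prefix-suffix-disjoint : (p : Walk G u v) → IsPath p → (y∈p : y ∈ₗ verts G p) →
    z ∈ₗ verts G (prefixTo p y∈p) → z ∈ₗ verts G (suffixFrom p y∈p) → z ≡ y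
  prefix-suffix-disjoint [] _ (here refl) (here refl) _ = refl
  prefix-suffix-disjoint (_ ∷ _) _ (here refl) (here refl) _ = refl
  prefix-suffix-disjoint (_ ∷ p) p! (there y∈p) (here refl) z∈suf =
    ⊥-elim (Unique[x∷xs]⇒x∉xs p! (suffixFrom-⊆ p y∈p z∈suf))
  prefix-suffix-disjoint (_ ∷ p) (_ ∷ p!) (there y∈p) (there z∈pre) z∈suf =
    prefix-suffix-disjoint p p! y∈p z∈pre z∈suf

  suffixFrom-path : (p : Walk G u v) → IsPath p → (x∈p : x ∈ₗ verts G p) → IsPath (suffixFrom p x∈p)
  suffixFrom-path [] p! (here refl) = p!
  suffixFrom-path (_ ∷ _) p! (here refl) = p!
  suffixFrom-path (_ ∷ p) (_ ∷ p!) (there x∈p) = suffixFrom-path p p! x∈p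

  eraseLoops : (p : Walk G u v) → Σ (Walk G u v) λ q → IsPath q × verts G q ⊆ₗ verts G p
  eraseLoops [] = [] , [] ∷ [] , id
  eraseLoops (_∷_ {u} e p) with eraseLoops p
  ... | q , q! , q⊆p with u ∈ₗ? verts G q
  ...   | yes u∈q = suffixFrom q u∈q , suffixFrom-path q q! u∈q , there ∘ q⊆p ∘ suffixFrom-⊆ q u∈q
  ...   | no u∉q = e ∷ q , path-∷ e q u∉q q! , λ { (here refl) → here refl ; (there x∈q) → there (q⊆p x∈q) }

  length-verts : (p : Walk G u v) → length (verts G p) ≡ suc (len G p)
  length-verts [] = refl
  length-verts (_ ∷ p) = cong suc (length-verts p)

  path-len< : (p : Walk G u v) → IsPath p → len G p < n
  path-len< p p! = subst (_≤ n) (length-verts p) (unique⇒length≤ p!)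

  path-snoc : (p : Walk G u v) (e : Edge G v w) → IsPath p → w ∉ₗ verts G p → IsPath (p ++ (e ∷ []))
  path-snoc [] e _ _ = path-∷ e [] (λ { (here refl) → edge⇒≢ e refl }) ([] ∷ [])
  path-snoc {w = w} (_∷_ {u} f p) e (u∉p ∷ p!) w∉fp =
    path-∷ f (p ++ (e ∷ [])) u∉p++e (path-snoc p e p! (w∉fp ∘ there))
    where
    u∉p++e : u ∉ₗ verts G (p ++ (e ∷ []))
    u∉p++e = [ Unique[x∷xs]⇒x∉xs (u∉p ∷ p!)
             , (λ { (here refl) → Unique[x∷xs]⇒x∉xs (u∉p ∷ p!) (target∈verts p)
                  ; (there (here refl)) → w∉fp (here refl) }) ]
             ∘ ∈-++⁻ p

  path-reverse : (p : Walk G u v) → IsPath p → IsPath (reverse p)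
  path-reverse [] p! = p!
  path-reverse (e ∷ p) (u∉p ∷ p!) = path-snoc (reverse p) (edge-sym e) (path-reverse p p!)
    (Unique[x∷xs]⇒x∉xs (u∉p ∷ p!) ∘ ∈-reverse⁻ p)

  Induced : Walk G u v → Set
  Induced p = IsPath p × (∀ {x y} → x ∈ₗ verts G p → y ∈ₗ verts G p → Edge G x y → UsesEdge G x y p)

  induced-[] : Induced {u} []
  induced-[] = [] ∷ [] , λ { (here refl) (here refl) uu → ⊥-elim (edge⇒≢ uu refl) }

  induced-∷ : (e : Edge G u w) (p : Walk G w v) → Induced p → u ∉ₗ verts G p →
              (∀ {y} → y ∈ₗ verts G p → y ≢ w → ¬ Edge G u y) → Induced (e ∷ p)
  induced-∷ {u} {w} e p (p! , edges) u∉p no-chord = path-∷ e p u∉p p! , edges′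
    where
    edges′ : x ∈ₗ verts G (e ∷ p) → y ∈ₗ verts G (e ∷ p) → Edge G x y → UsesEdge G x y (e ∷ p)
    edges′ (here refl) (here refl) uu = ⊥-elim (edge⇒≢ uu refl)
    edges′ {y = y} (here refl) (there y∈p) uy with y ≟ w
    ... | yes refl = inj₁ (inj₁ (refl , refl))
    ... | no y≢w = ⊥-elim (no-chord y∈p y≢w uy)
    edges′ {x} (there x∈p) (here refl) xu with x ≟ w
    ... | yes refl = inj₁ (inj₂ (refl , refl))
    ... | no x≢w = ⊥-elim (no-chord x∈p x≢w (edge-sym xu))
    edges′ (there x∈p) (there y∈p) xy = inj₂ (edges x∈p y∈p xy)

  induced-∷⁻ : (e : Edge G u w) (p : Walk G w v) → Induced (e ∷ p) →
               Induced p × u ∉ₗ verts G p × (∀ {y} → y ∈ₗ verts G p → y ≢ w → ¬ Edge G u y)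
  induced-∷⁻ {u} {w} e p (ep!@(_ ∷ p!) , edges) = (p! , edges-p) , u∉p , no-chord
    where
    u∉p : u ∉ₗ verts G p
    u∉p = Unique[x∷xs]⇒x∉xs ep!
    edges-p : x ∈ₗ verts G p → y ∈ₗ verts G p → Edge G x y → UsesEdge G x y p
    edges-p x∈p y∈p xy with edges (there x∈p) (there y∈p) xy
    ... | inj₁ (inj₁ (refl , _)) = ⊥-elim (u∉p x∈p)
    ... | inj₁ (inj₂ (refl , _)) = ⊥-elim (u∉p y∈p)
    ... | inj₂ uses = uses
    no-chord : y ∈ₗ verts G p → y ≢ w → ¬ Edge G u y
    no-chord y∈p y≢w uy with edges (here refl) (there y∈p) uy
    ... | inj₁ (inj₁ (_ , w≡y)) = y≢w (sym w≡y)
    ... | inj₁ (inj₂ (u≡y , _)) = edge⇒≢ uy u≡y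
    ... | inj₂ uses = u∉p (uses⇒∈verts p uses)

  induced-edge : (e : Edge G u v) → Induced (e ∷ [])
  induced-edge e = induced-∷ e [] induced-[] (λ { (here refl) → edge⇒≢ e refl })
                                             (λ { (here refl) v≢v → ⊥-elim (v≢v refl) })

  induced-reverse : (p : Walk G u v) → Induced p → Induced (reverse p)
  induced-reverse p (p! , edges) = path-reverse p p! , λ x∈ y∈ xy →
    uses-reverse p (edges (∈-reverse⁻ p x∈) (∈-reverse⁻ p y∈) xy)

  -- Shortest walks and simplicial vertices

  ¬¬shortest : Walk G u v → ¬ ¬ Σ (Walk G u v) (Shortest G)
  ¬¬shortest {u} {v} p none = descend p (<-wellFounded (len G p))
    where
    descend : (p : Walk G u v) → Acc _<_ (len G p) → ⊥
    descend p (acc shorter) = none (p , λ q → decidable-stable (len G p ℕ.≤? len G q) λ p≰q →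
      descend q (shorter (ℕ.≰⇒> p≰q)))

  shortest⇒induced : (p : Walk G u v) → Shortest G p → Induced p
  shortest⇒induced [] _ = induced-[]
  shortest⇒induced (_∷_ {u} {w} e p) e∷p-shortest =
    induced-∷ e p (shortest⇒induced p p-shortest) u∉p no-chord
    where
    p-shortest : Shortest G p
    p-shortest q = ℕ.≤-pred (e∷p-shortest (e ∷ q))
    u∉p : u ∉ₗ verts G p
    u∉p u∈p = ℕ.<⇒≱ (s≤s (len-suffixFrom p u∈p)) (e∷p-shortest (suffixFrom p u∈p))
    no-chord : y ∈ₗ verts G p → y ≢ w → ¬ Edge G u y
    no-chord y∈p y≢w uy = ℕ.<⇒≱ (s≤s (len-suffixFrom< p y∈p y≢w)) (e∷p-shortest (uy ∷ suffixFrom p y∈p))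

  Simplicial : Fin n → Set
  Simplicial v = ∀ {a b} → Edge G v a → Edge G v b → a ≢ b → Edge G a b

  simplicial-not-second : (e : Edge G u v) (p : Walk G v x) → Induced (e ∷ p) → Simplicial v → v ≢ x → ⊥
  simplicial-not-second e [] _ _ v≢x = v≢x refl
  simplicial-not-second e (f ∷ p) ind simp _ with induced-∷⁻ e (f ∷ p) ind
  ... | _ , u∉fp , no-chord = no-chord (there (source∈verts p)) (edge⇒≢ f ∘ sym)
          (simp (edge-sym e) f λ { refl → u∉fp (there (source∈verts p)) })

  simplicial-not-interior : (p : Walk G u x) → Induced p → Simplicial v →
                            v ∈ₗ verts G p → v ≢ u → v ≢ x → ⊥
  simplicial-not-interior [] _ _ (here refl) v≢u _ = v≢u refl
  simplicial-not-interior (_ ∷ _) _ _ (here refl) v≢u _ = v≢u refl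
  simplicial-not-interior {v = v} (_∷_ {w = w} e p) ind simp (there v∈p) _ v≢x with v ≟ w
  ... | yes refl = simplicial-not-second e p ind simp v≢x
  ... | no v≢w = simplicial-not-interior p (proj₁ (induced-∷⁻ e p ind)) simp v∈p v≢w v≢x

  meg-contains-simplicial : Connected G → {M : Subset n} → IsMEGSet G M → Simplicial v → Edge G v w → v ∈ M
  meg-contains-simplicial {v} conn {M} meg simp vw with meg _ _ vw
  ... | u , x , u∈M , x∈M , monitors = decidable-stable (v ∈? M) λ v∉M →
    ¬¬shortest (conn u x) λ (p , p-shortest) →
      simplicial-not-interior p (shortest⇒induced p p-shortest) simp
        (uses⇒∈verts p (monitors p p-shortest)) (λ { refl → v∉M u∈M }) (λ { refl → v∉M x∈M })

  has-neighbour : Connected G → 2 ≤ n → ∀ v → ∃[ w ] Edge G v w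
  has-neighbour conn 2≤n v with another-vertex 2≤n v
  ... | w , w≢v = first-edge (conn v w) (w≢v ∘ sym)
    where
    first-edge : Walk G v w → v ≢ w → ∃[ w ] Edge G v w
    first-edge [] v≢v = ⊥-elim (v≢v refl)
    first-edge (vu ∷ _) _ = _ , vu

  -- Cycles and cut vertices

  cycle-nonseparable : (e : Edge G w x) (q : Walk G x r) → IsPath (e ∷ q) → Edge G r w →
                       Nonseparable G (vertexSet (verts G (e ∷ q)))
  cycle-nonseparable {w} {r = r} e q c! rw = connected , no-cut
    where
    c : Walk G w r
    c = e ∷ q
    S : Subset n
    S = vertexSet (verts G c)

    within : (s : Walk G y z) → verts G s ⊆ₗ verts G c → WalkIn G S s
    within s s⊆c = All.tabulate (∈-vertexSet⁺ ∘ s⊆c)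

    connected : ∀ y z → y ∈ S → z ∈ S → Σ (Walk G y z) (WalkIn G S)
    connected y z y∈S z∈S with connect-within c (∈-vertexSet⁻ _ y∈S) (∈-vertexSet⁻ _ z∈S)
    ... | s , s⊆c = s , within s s⊆c

    -- Going round the cycle one way or the other avoids any vertex z other than y and w.
    route : y ∈ₗ verts G c → y ≢ z → z ≢ w →
            Σ (Walk G y w) λ s → verts G s ⊆ₗ verts G c × z ∉ₗ verts G s
    route {y} {z} y∈c y≢z z≢w with z ∈ₗ? verts G (prefixTo c y∈c)
    ... | no z∉pre = reverse (prefixTo c y∈c) , prefixTo-⊆ c y∈c ∘ ∈-reverse⁻ _ , z∉pre ∘ ∈-reverse⁻ _
    ... | yes z∈pre = suf ++ (rw ∷ []) ,
                      [ suffixFrom-⊆ c y∈c , (λ { (here refl) → target∈verts c ; (there (here refl)) → here refl }) ]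
                        ∘ ∈-++⁻ suf ,
                      [ z∉suf , (λ { (here refl) → z∉suf (target∈verts suf) ; (there (here refl)) → z≢w refl }) ]
                        ∘ ∈-++⁻ suf
      where
      suf : Walk G y r
      suf = suffixFrom c y∈c
      z∉suf : z ∉ₗ verts G suf
      z∉suf z∈suf = y≢z (sym (prefix-suffix-disjoint c c! y∈c z∈pre z∈suf))

    ∈-q : y ∈ S → y ≢ w → y ∈ₗ verts G q
    ∈-q y∈S y≢w with ∈-vertexSet⁻ _ y∈S
    ... | here refl = ⊥-elim (y≢w refl)
    ... | there y∈q = y∈q

    avoiding : y₁ ∈ S → y₂ ∈ S → y₁ ≢ z → y₂ ≢ z →
               Σ (Walk G y₁ y₂) λ s → WalkIn G S s × z ∉ₗ verts G s
    avoiding {z = z} y₁∈S y₂∈S y₁≢z y₂≢z with z ≟ w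
    ... | yes refl =
      let s , s⊆q = connect-within q (∈-q y₁∈S y₁≢z) (∈-q y₂∈S y₂≢z)
      in s , within s (there ∘ s⊆q) , Unique[x∷xs]⇒x∉xs c! ∘ s⊆q
    ... | no z≢w =
      let s₁ , s₁⊆c , z∉s₁ = route (∈-vertexSet⁻ _ y₁∈S) y₁≢z z≢w
          s₂ , s₂⊆c , z∉s₂ = route (∈-vertexSet⁻ _ y₂∈S) y₂≢z z≢w
      in s₁ ++ reverse s₂ ,
         within (s₁ ++ reverse s₂) ([ s₁⊆c , s₂⊆c ∘ ∈-reverse⁻ s₂ ] ∘ ∈-++⁻ s₁) ,
         [ z∉s₁ , z∉s₂ ∘ ∈-reverse⁻ s₂ ] ∘ ∈-++⁻ s₁

    no-cut : ∀ z → CutVertexIn G S z → ⊥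
    no-cut z (_ , _ , _ , y₁∈S , y₂∈S , y₁≢z , y₂≢z , separates) =
      let s , s∈S , z∉s = avoiding y₁∈S y₂∈S y₁≢z y₂≢z in z∉s (separates s s∈S)

  stop-before : (p : Walk G y z) → y ≢ z → ∃[ r ] Edge G r z × Σ (Walk G y r) λ s → z ∉ₗ verts G s
  stop-before [] y≢y = ⊥-elim (y≢y refl)
  stop-before {z = z} (_∷_ {w = w} e p) y≢z with w ≟ z
  ... | yes refl = _ , e , [] , λ { (here z≡y) → y≢z (sym z≡y) }
  ... | no w≢z with stop-before p w≢z
  ...   | r , rz , s , z∉s = r , rz , e ∷ s , λ { (here z≡y) → y≢z (sym z≡y) ; (there z∈s) → z∉s z∈s }

  cut⇒far-neighbour : Connected G → CutVertex G z → Edge G z w →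
                      ∃[ r ] Edge G z r × r ≢ w × ¬ Edge G r w
  cut⇒far-neighbour {z} {w} conn (_ , y₁ , y₂ , _ , _ , y₁≢z , y₂≢z , separates) zw =
    decidable-stable (any? λ r → edge? z r ×-dec ¬? (r ≟ w) ×-dec ¬? (edge? r w)) λ no-far →
      let s₁ , z∉s₁ = towards-w y₁≢z no-far
          s₂ , z∉s₂ = towards-w y₂≢z no-far
      in [ z∉s₁ , z∉s₂ ∘ ∈-reverse⁻ s₂ ] (∈-++⁻ s₁ (separates (s₁ ++ reverse s₂) (All.tabulate λ _ → ∈⊤)))
    where
    -- Were every neighbour r ≢ w of z adjacent to w, a walk into z could be diverted to w just before z.
    towards-w : y ≢ z → ¬ (∃[ r ] Edge G z r × r ≢ w × ¬ Edge G r w) → Σ (Walk G y w) λ s → z ∉ₗ verts G s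
    towards-w {y} y≢z no-far with stop-before (conn y z) y≢z
    ... | r , rz , s , z∉s with r ≟ w
    ...   | yes refl = s , z∉s
    ...   | no r≢w = s ++ (rw ∷ []) ,
                     [ z∉s , (λ { (here z≡r) → edge⇒≢ rz (sym z≡r) ; (there (here z≡w)) → edge⇒≢ zw z≡w }) ]
                       ∘ ∈-++⁻ s
      where
      rw : Edge G r w
      rw = decidable-stable (edge? r w) λ ¬rw → no-far (r , edge-sym rz , r≢w , ¬rw)

  -- Block graphs

  module _ (bg : BlockGraph G) where

    nonseparable⇒clique : {S : Subset n} → Nonseparable G S → IsClique G S
    nonseparable⇒clique ns x y x∈S y∈S x≢y = decidable-stable (edge? x y) λ ¬xy →
      ¬¬maximal-superset (Nonseparable G) ns λ (B , S⊆B , nsB , maximal) →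
        ¬xy (bg B (nsB , maximal) x y (S⊆B x∈S) (S⊆B y∈S) x≢y)

    common-neighbours-adjacent : Edge G w x → Edge G w y → x ≢ y →
                                 (p : Walk G x y) → w ∉ₗ verts G p → Edge G x y
    common-neighbours-adjacent wx wy x≢y p w∉p with eraseLoops p
    ... | q , q! , q⊆p =
      nonseparable⇒clique (cycle-nonseparable wx q (path-∷ wx q (w∉p ∘ q⊆p) q!) (edge-sym wy)) _ _
        (∈-vertexSet⁺ (there (source∈verts q))) (∈-vertexSet⁺ (there (target∈verts q))) x≢y

    ¬cut⇒simplicial : ¬ CutVertex G v → Simplicial v
    ¬cut⇒simplicial {v} ¬cut {a} {b} va vb a≢b = decidable-stable (edge? a b) λ ¬ab →
      ¬cut (∈⊤ , a , b , ∈⊤ , ∈⊤ , edge⇒≢ va ∘ sym , edge⇒≢ vb ∘ sym , λ p _ →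
        decidable-stable (v ∈ₗ? verts G p) (¬ab ∘ common-neighbours-adjacent va vb a≢b p))

    induced-prepend : (f : Edge G r u) (e : Edge G u w) (p : Walk G w v) → Induced (e ∷ p) →
                      r ≢ w → ¬ Edge G r w → Induced (f ∷ e ∷ p)
    induced-prepend {r} {u} {w} f e p ind r≢w ¬rw with induced-∷⁻ e p ind
    ... | _ , u∉p , _ = induced-∷ f (e ∷ p) ind r∉ep no-chord
      where
      no-return : (s : Walk G w r) → u ∉ₗ verts G s → ⊥
      no-return s u∉s = ¬rw (edge-sym (common-neighbours-adjacent e (edge-sym f) (r≢w ∘ sym) s u∉s))
      r∉ep : r ∉ₗ verts G (e ∷ p)
      r∉ep (here refl) = edge⇒≢ f refl
      r∉ep (there r∈p) = no-return (prefixTo p r∈p) (u∉p ∘ prefixTo-⊆ p r∈p)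
      no-chord : y ∈ₗ verts G (e ∷ p) → y ≢ u → ¬ Edge G r y
      no-chord (here refl) y≢u _ = y≢u refl
      no-chord (there y∈p) _ ry = no-return (prefixTo p y∈p ++ (edge-sym ry ∷ []))
        ([ u∉p ∘ prefixTo-⊆ p y∈p
         , (λ { (here refl) → u∉p y∈p ; (there (here refl)) → edge⇒≢ f refl }) ] ∘ ∈-++⁻ (prefixTo p y∈p))

    induced-first-steps-adjacent : (e : Edge G u y₁) (p : Walk G y₁ x) (f : Edge G u y₂) (q : Walk G y₂ x) →
      Induced (e ∷ p) → Induced (f ∷ q) → y₁ ≢ y₂ → Edge G y₁ y₂
    induced-first-steps-adjacent e p f q ind-ep ind-fq y₁≢y₂
      with induced-∷⁻ e p ind-ep | induced-∷⁻ f q ind-fq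
    ... | _ , u∉p , _ | _ , u∉q , _ =
      common-neighbours-adjacent e f y₁≢y₂ (p ++ reverse q) ([ u∉p , u∉q ∘ ∈-reverse⁻ q ] ∘ ∈-++⁻ p)

    induced-first-step : (e : Edge G u y₁) (p : Walk G y₁ x) (f : Edge G u y₂) (q : Walk G y₂ x) →
                         Induced (e ∷ p) → Induced (f ∷ q) → y₁ ≡ y₂
    induced-first-step e [] f q _ ind-fq = decidable-stable (_ ≟ _) λ y₁≢y₂ →
      proj₂ (proj₂ (induced-∷⁻ f q ind-fq)) (target∈verts q) y₁≢y₂ e
    induced-first-step {u} {y₁} {y₂ = y₂} e (_∷_ {w = y₃} g p) f q ind-ep ind-fq
      with induced-∷⁻ e (g ∷ p) ind-ep | induced-∷⁻ f q ind-fq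
    ... | ind-gp , u∉gp , chord-gp | _ , _ , chord-q = decidable-stable (y₁ ≟ y₂) diverge
      where
      y₃∈gp : y₃ ∈ₗ verts G (g ∷ p)
      y₃∈gp = there (source∈verts p)
      -- Otherwise the triangle u y₁ y₂ and the walk y₂ ⇝ x ⇝ y₃ around y₁ force the chord u y₃.
      diverge : ¬ y₁ ≢ y₂
      diverge y₁≢y₂ = chord-gp y₃∈gp (edge⇒≢ g ∘ sym) uy₃
        where
        y₁∉q : y₁ ∉ₗ verts G q
        y₁∉q y₁∈q = chord-q y₁∈q y₁≢y₂ e
        y₁∉p : y₁ ∉ₗ verts G p
        y₁∉p = proj₁ (proj₂ (induced-∷⁻ g p ind-gp))
        y₂≢y₃ : y₂ ≢ y₃
        y₂≢y₃ y₂≡y₃ = chord-gp (subst (_∈ₗ verts G (g ∷ p)) (sym y₂≡y₃) y₃∈gp) (y₁≢y₂ ∘ sym) f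
        y₂y₃ : Edge G y₂ y₃
        y₂y₃ = common-neighbours-adjacent (induced-first-steps-adjacent e (g ∷ p) f q ind-ep ind-fq y₁≢y₂) g
                 y₂≢y₃ (q ++ reverse p) ([ y₁∉q , y₁∉p ∘ ∈-reverse⁻ p ] ∘ ∈-++⁻ q)
        y₂∉uy₁y₃ : y₂ ∉ₗ verts G (e ∷ g ∷ [])
        y₂∉uy₁y₃ (here y₂≡u) = edge⇒≢ f (sym y₂≡u)
        y₂∉uy₁y₃ (there (here y₂≡y₁)) = y₁≢y₂ (sym y₂≡y₁)
        y₂∉uy₁y₃ (there (there (here y₂≡y₃))) = y₂≢y₃ y₂≡y₃
        u≢y₃ : u ≢ y₃
        u≢y₃ u≡y₃ = u∉gp (subst (_∈ₗ verts G (g ∷ p)) (sym u≡y₃) y₃∈gp)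
        uy₃ : Edge G u y₃
        uy₃ = common-neighbours-adjacent (edge-sym f) y₂y₃ u≢y₃ (e ∷ g ∷ []) y₂∉uy₁y₃

    induced-unique : (p q : Walk G u x) → Induced p → Induced q → UsesEdge G a b p → UsesEdge G a b q
    induced-unique [] _ _ _ ()
    induced-unique (e ∷ p) [] ind-ep _ _ = proj₁ (proj₂ (induced-∷⁻ e p ind-ep)) (target∈verts p)
    induced-unique (e ∷ p) (f ∷ q) ind-ep ind-fq uses with induced-first-step e p f q ind-ep ind-fq | uses
    ... | refl | inj₁ head = inj₁ head
    ... | refl | inj₂ uses-p =
      inj₂ (induced-unique p q (proj₁ (induced-∷⁻ e p ind-ep)) (proj₁ (induced-∷⁻ f q ind-fq)) uses-p)

    induced-monitors : (p : Walk G u x) → Induced p → UsesEdge G a b p → Monitors G u x a b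
    induced-monitors p ind uses q q-shortest = induced-unique p q ind (shortest⇒induced q q-shortest) uses

    extend-to-non-cut : Connected G → Decidable (CutVertex G) →
                        (p : Walk G u v) → Induced p → UsesEdge G a b p →
                        ∃[ x ] ¬ CutVertex G x × Σ (Walk G x v) λ p′ → Induced p′ × UsesEdge G a b p′
    extend-to-non-cut {v = v} {a} {b} conn cut? p ind uses = grow n p ind uses (ℕ.m≤m+n n (len G p))
      where
      grow : ∀ k {u} (p : Walk G u v) → Induced p → UsesEdge G a b p → n ≤ k + len G p →
             ∃[ x ] ¬ CutVertex G x × Σ (Walk G x v) λ p′ → Induced p′ × UsesEdge G a b p′
      grow zero p ind _ n≤len = ⊥-elim (ℕ.<⇒≱ (path-len< p (proj₁ ind)) n≤len)
      grow (suc k) {u} (e ∷ p) ind uses n≤ with cut? u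
      ... | no ¬cut = u , ¬cut , e ∷ p , ind , uses
      ... | yes cut with cut⇒far-neighbour conn cut e
      ...   | r , ur , r≢w , ¬rw = grow k (edge-sym ur ∷ e ∷ p) (induced-prepend (edge-sym ur) e p ind r≢w ¬rw)
                                     (inj₂ uses) (subst (n ≤_) (sym (ℕ.+-suc k _)) n≤)

    non-cut-vertices-MEG : Connected G → (C : Subset n) → (∀ v → v ∈ C ⇔ CutVertex G v) → IsMEGSet G (∁ C)
    non-cut-vertices-MEG conn C C⇔cut a b ab =
      let x , ¬cut-x , p , ind-p , uses-p =
            extend-to-non-cut conn cut? (ab ∷ []) (induced-edge ab) (inj₁ (inj₁ (refl , refl)))
          y , ¬cut-y , q , ind-q , uses-q =
            extend-to-non-cut conn cut? (reverse p) (induced-reverse p ind-p) (uses-reverse p uses-p)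
      in y , x , non-cut∈∁C ¬cut-y , non-cut∈∁C ¬cut-x , induced-monitors q ind-q uses-q
      where
      cut? : Decidable (CutVertex G)
      cut? v = Dec.map (C⇔cut v) (v ∈? C)
      non-cut∈∁C : ¬ CutVertex G v → v ∈ ∁ C
      non-cut∈∁C {v} ¬cut = x∉p⇒x∈∁p (¬cut ∘ Equivalence.to (C⇔cut v))

mainTheorem10 : ∀ (n : ℕ) (G : Graph n) → Connected G → 2 ≤ n → BlockGraph G →
    (C : Subset n) → (∀ v → (v ∈ C) ⇔ CutVertex G v) →
    MegIs G (n ∸ ∣ C ∣)
mainTheorem10 n G conn 2≤n bg C C⇔cut =
  (∁ C , non-cut-vertices-MEG G bg conn C C⇔cut , ∣∁p∣≡n∸∣p∣ C) , minimal
  where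
  non-cut⊆MEG : {M : Subset n} → IsMEGSet G M → ∁ C ⊆ M
  non-cut⊆MEG meg {v} v∈∁C =
    meg-contains-simplicial G conn meg (¬cut⇒simplicial G bg (x∈∁p⇒x∉p v∈∁C ∘ Equivalence.from (C⇔cut v)))
      (proj₂ (has-neighbour G conn 2≤n v))
  minimal : ∀ M → IsMEGSet G M → n ∸ ∣ C ∣ ≤ ∣ M ∣
  minimal M meg = subst (_≤ ∣ M ∣) (∣∁p∣≡n∸∣p∣ C) (p⊆q⇒∣p∣≤∣q∣ (non-cut⊆MEG meg))
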